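{- Let $\rho:R'\to R$ be a surjective ring homomorphism of commutative rings with identity, let $G=(V,E)$ be a finite graph and $\alpha:E\to\{\text{ideals of }R\}$ an edge-labeling. Then the map $\rho_*:R'_{G,\rho^{ -1}(\alpha)}\to R_{G,\alpha}$, $(\rho_* f)_v=\rho(f_v)$, is surjective.
   Context: For a finite graph $G=(V,E)$, a commutative ring $R$ with identity and an edge-labeling $\alpha:E\to\{\text{ideals of }R\}$, a spline is $f\in R^{|V|}$ with $f_u-f_v\in\alpha(uv)$ for every edge $uv$; $R_{G,\alpha}$ is the set of splines. For a ring homomorphism $\rho:R'\to R$, $\rho^{ -1}(\alpha)$ denotes the edge-labeling of $G$ by ideals of $R'$ given by $e\mapsto\rho^{ -1}(\alpha(e))$, and $\rho_*$ is the restriction of the coordinatewise map $(R')^{|V|}\to R^{|V|}$ to splines (it maps splines to splines). -}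

module Defs where

open import Level using (Level; _⊔_; suc)
open import Data.Nat using (ℕ)
open import Data.Fin using (Fin)
open import Data.Product using (_×_; _,_; proj₁; proj₂; Σ)
open import Relation.Unary using (Pred)
open import Algebra.Bundles using (CommutativeRing)
open import Algebra.Morphism.Structures using (IsRingHomomorphism)

-- An ideal of a commutative ring, given as a subset of the carrier
-- (a predicate) that respects the ring's equality, contains 0, is closed
-- under addition, and absorbs multiplication by arbitrary ring elements.
-- (Closure under negation follows: -x = (-1) * x.)
record Ideal {c ℓ : Level} (R : CommutativeRing c ℓ) (p : Level) : Set (c ⊔ ℓ ⊔ Level.suc p) where
  open CommutativeRing R
  field
    _∈I        : Pred Carrier p
    ∈-resp-≈   : ∀ {x y} → x ≈ y → x ∈I → y ∈I
    0∈         : 0# ∈I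
    +-closed   : ∀ {x y} → x ∈I → y ∈I → (x + y) ∈I
    *-closedˡ  : ∀ r {x} → x ∈I → (r * x) ∈I

open Ideal public

record RingHom {c₁ ℓ₁ c₂ ℓ₂ : Level}
               (R' : CommutativeRing c₁ ℓ₁) (R : CommutativeRing c₂ ℓ₂)
               : Set (c₁ ⊔ ℓ₁ ⊔ c₂ ⊔ ℓ₂) where
  field
    ⟦_⟧    : CommutativeRing.Carrier R' → CommutativeRing.Carrier R
    isHom  : IsRingHomomorphism (CommutativeRing.rawRing R') (CommutativeRing.rawRing R) ⟦_⟧

open RingHom public

Surjective : ∀ {c₁ ℓ₁ c₂ ℓ₂} {R' : CommutativeRing c₁ ℓ₁} {R : CommutativeRing c₂ ℓ₂}
             → RingHom R' R → Set (c₁ ⊔ c₂ ⊔ ℓ₂)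
Surjective {R' = R'} {R = R} ρ =
  ∀ (y : CommutativeRing.Carrier R) →
    Σ (CommutativeRing.Carrier R') (λ x → CommutativeRing._≈_ R (⟦ ρ ⟧ x) y)

preimage : ∀ {c₁ ℓ₁ c₂ ℓ₂ p} {R' : CommutativeRing c₁ ℓ₁} {R : CommutativeRing c₂ ℓ₂}
           → RingHom R' R → Ideal R p → Ideal R' p
preimage {R' = R'} {R = R} ρ I = record
  { _∈I      = λ x → (I ∈I) (⟦ ρ ⟧ x)
  ; ∈-resp-≈ = λ x≈y → ∈-resp-≈ I (⟦⟧-cong x≈y)
  ; 0∈       = ∈-resp-≈ I (R.sym 0#-homo) (0∈ I)
  ; +-closed = λ {x} {y} hx hy → ∈-resp-≈ I (R.sym (+-homo x y)) (+-closed I hx hy)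
  ; *-closedˡ = λ r {x} hx → ∈-resp-≈ I (R.sym (*-homo r x)) (*-closedˡ I (⟦ ρ ⟧ r) hx)
  }
  where
  module R = CommutativeRing R
  open IsRingHomomorphism (isHom ρ)

-- A finite graph G = (V, E): vertices Fin n, edges indexed by Fin m, each
-- edge having two endpoints (multigraphs/loops are harmless here).
record Graph : Set where
  field
    nV    : ℕ
    nE    : ℕ
    ends  : Fin nE → Fin nV × Fin nV

open Graph public

Labeling : ∀ {c ℓ} (G : Graph) (R : CommutativeRing c ℓ) (p : Level) → Set (c ⊔ ℓ ⊔ Level.suc p)
Labeling G R p = Fin (nE G) → Ideal R p

preimageLabeling : ∀ {c₁ ℓ₁ c₂ ℓ₂ p} {R' : CommutativeRing c₁ ℓ₁} {R : CommutativeRing c₂ ℓ₂}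
                   {G : Graph} → RingHom R' R → Labeling G R p → Labeling G R' p
preimageLabeling ρ α e = preimage ρ (α e)

IsSpline : ∀ {c ℓ p} (R : CommutativeRing c ℓ) (G : Graph) → Labeling G R p
           → (Fin (nV G) → CommutativeRing.Carrier R) → Set p
IsSpline R G α f =
  ∀ (e : Fin (nE G)) →
    (α e ∈I) (f (proj₁ (ends G e)) - f (proj₂ (ends G e)))
  where open CommutativeRing R

Spline : ∀ {c ℓ p} (R : CommutativeRing c ℓ) (G : Graph) → Labeling G R p → Set (c ⊔ p)
Spline R G α = Σ (Fin (nV G) → CommutativeRing.Carrier R) (IsSpline R G α)

push : ∀ {c₁ ℓ₁ c₂ ℓ₂} {R' : CommutativeRing c₁ ℓ₁} {R : CommutativeRing c₂ ℓ₂} {n : ℕ}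
       → RingHom R' R → (Fin n → CommutativeRing.Carrier R') → (Fin n → CommutativeRing.Carrier R)
push ρ f v = ⟦ ρ ⟧ (f v)

module Submission where

-- The spline condition is a condition on differences f_u - f_v, and ρ
-- carries differences to differences.  Hence ANY vector f over R' whose
-- image ρ ∘ f agrees (up to ≈) with a spline g over (G, α) is itself a
-- spline over (G, ρ⁻¹(α)): the image of f_u - f_v is ρ(f_u) - ρ(f_v)
-- ≈ g_u - g_v ∈ α(uv), which is exactly membership in ρ⁻¹(α(uv)).

open import Defs
open import Level using (Level)
open import Data.Fin using (Fin)
open import Data.Product using (Σ; proj₁; proj₂; _,_)
open import Algebra.Bundles using (CommutativeRing)
open import Algebra.Morphism.Structures using (IsRingHomomorphism)

module _ {c₁ ℓ₁ c₂ ℓ₂ : Level}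
         {R' : CommutativeRing c₁ ℓ₁} {R : CommutativeRing c₂ ℓ₂}
         (ρ : RingHom R' R) where

  private
    module R  = CommutativeRing R
    module R' = CommutativeRing R'
  open IsRingHomomorphism (isHom ρ) using (+-homo; -‿homo)

  ρ-difference : ∀ x y → ⟦ ρ ⟧ (x R'.- y) R.≈ ⟦ ρ ⟧ x R.- ⟦ ρ ⟧ y
  ρ-difference x y = R.trans (+-homo x (R'.- y)) (R.+-congˡ (-‿homo y))

  lift-isSpline : ∀ {p} (G : Graph) (α : Labeling G R p)
                  (g : Fin (nV G) → R.Carrier) (f : Fin (nV G) → R'.Carrier) →
                  IsSpline R G α g →
                  (∀ v → push ρ f v R.≈ g v) →
                  IsSpline R' G (preimageLabeling {G = G} ρ α) f
  lift-isSpline G α g f g-spline ρf≈g e =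
    ∈-resp-≈ (α e) g-difference≈ρ-difference (g-spline e)
    where
    u w : Fin (nV G)
    u = proj₁ (ends G e)
    w = proj₂ (ends G e)
    g-difference≈ρ-difference : g u R.- g w R.≈ ⟦ ρ ⟧ (f u R'.- f w)
    g-difference≈ρ-difference = R.sym (R.trans
      (ρ-difference (f u) (f w))
      (R.+-cong (ρf≈g u) (R.-‿cong (ρf≈g w))))

mainTheorem3 : ∀ {c₁ ℓ₁ c₂ ℓ₂ p : Level}
    (R' : CommutativeRing c₁ ℓ₁) (R : CommutativeRing c₂ ℓ₂)
    (ρ : RingHom R' R) → Surjective ρ →
    (G : Graph) (α : Labeling G R p) →
    (g : Spline R G α) →
    Σ (Spline R' G (preimageLabeling {G = G} ρ α))
    (λ f → ∀ (v : Fin (nV G)) →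
    CommutativeRing._≈_ R (push ρ (proj₁ f) v) (proj₁ g v))
mainTheorem3 R' R ρ surjective G α (g , g-spline) =
  (f , lift-isSpline ρ G α g f g-spline ρf≈g) , ρf≈g
  where
  f : Fin (nV G) → CommutativeRing.Carrier R'
  f v = proj₁ (surjective (g v))
  ρf≈g : ∀ v → CommutativeRing._≈_ R (push ρ f v) (g v)
  ρf≈g v = proj₂ (surjective (g v))
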